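{- Let $H$ and $G$ be graphs and let $k\geq 1$ be an integer. If $H$ is $k$-$G$-free-vertex-minimal, then \[|V(H)|\geq (k-1)(|V(G)|-1)+1.\]
   Context: All graphs are finite, simple and undirected. For a graph $G$ on at least 2 vertices, a $G$-free $k$-colouring of a graph $H$ is a map $\pi:V(H)\to\{1,\dots,k\}$ such that for every $i$ the subgraph of $H$ induced by $\pi^{ -1}(i)$ contains no subgraph isomorphic to $G$. The $G$-free chromatic number $\chi_G(H)$ is the least $k$ for which a $G$-free $k$-colouring of $H$ exists. $H$ is $G$-free-vertex-minimal if $\chi_G(H\setminus\{v\})\leq\chi_G(H)-1$ for every vertex $v\in V(H)$; $H$ is $k$-$G$-free-vertex-minimal if moreover $\chi_G(H)=k$. -}

module Defs where

open import Data.Nat using (ℕ; zero; suc; _≤_; _<_; _∸_)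
open import Data.Fin using (Fin; punchIn)
open import Data.Bool using (Bool; true; false)
open import Data.Product using (Σ; _×_; ∃)
open import Data.Empty using (⊥)
open import Data.Unit using (⊤)
open import Relation.Binary.PropositionalEquality using (_≡_)
open import Relation.Nullary using (¬_)
open import Function.Definitions using (Injective)

record Graph (n : ℕ) : Set where
  field
    adj    : Fin n → Fin n → Bool
    sym    : ∀ u v → adj u v ≡ adj v u
    irrefl : ∀ v → adj v v ≡ false
open Graph public

-- A copy of G (as a not necessarily induced subgraph) inside H whose
-- vertices all satisfy the predicate P: an injective map V(G) → V(H)
-- sending edges to edges, with image inside P.
SubgraphIn : ∀ {m n} → Graph m → Graph n → (Fin n → Set) → Set
SubgraphIn {m} {n} G H P =
  Σ (Fin m → Fin n) λ f →
    Injective _≡_ _≡_ f ×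
    (∀ u v → adj G u v ≡ true → adj H (f u) (f v) ≡ true) ×
    (∀ u → P (f u))

IsGFreeColouring : ∀ {m n} → Graph m → Graph n → (k : ℕ) → (Fin n → Fin k) → Set
IsGFreeColouring G H k π = ∀ (i : Fin k) → ¬ SubgraphIn G H (λ v → π v ≡ i)

GFreeColourable : ∀ {m n} → Graph m → Graph n → ℕ → Set
GFreeColourable {n = n} G H k = Σ (Fin n → Fin k) λ π → IsGFreeColouring G H k π

ChiG≡ : ∀ {m n} → Graph m → Graph n → ℕ → Set
ChiG≡ G H k = GFreeColourable G H k × (∀ j → j < k → ¬ GFreeColourable G H j)

deleteVertex : ∀ {n} → Graph (suc n) → Fin (suc n) → Graph n
deleteVertex H v = record
  { adj    = λ a b → adj H (punchIn v a) (punchIn v b)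
  ; sym    = λ a b → sym H (punchIn v a) (punchIn v b)
  ; irrefl = λ a → irrefl H (punchIn v a)
  }

VertexMinimalAux : ∀ {m n} → Graph m → Graph n → ℕ → Set
VertexMinimalAux {n = zero}  G H k = ⊤
VertexMinimalAux {n = suc n} G H k =
  ∀ (v : Fin (suc n)) → ∃ λ c → ChiG≡ G (deleteVertex H v) c × c ≤ k ∸ 1

KGFreeVertexMinimal : ∀ {m n} → Graph m → Graph n → ℕ → Set
KGFreeVertexMinimal G H k = ChiG≡ G H k × VertexMinimalAux G H k

{-# OPTIONS --safe #-}
module Submission where

-- Delete a vertex v of H and take a G-free (k-1)-colouring of H - v, which exists by minimality.
-- Giving v a colour i must create a monochromatic copy of G, since χ_G(H) = k; that copy passes
-- through v, so colour class i of H - v contains |V(G)| - 1 distinct vertices.  Hence every one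
-- of the k - 1 classes has at least |V(G)| - 1 vertices, and H - v has at least
-- (k - 1)(|V(G)| - 1) vertices.  Constructively the argument only shows that each class is
-- not small, i.e. ¬¬-large; this suffices because the final inequality is decidable.

open import Defs hiding (sym)
open import Data.Nat using (ℕ; zero; suc; _≤_; _+_; _*_; _∸_; z≤n; s≤s)
open import Data.Nat.Properties using (≤-refl; +-comm; _≤?_)
open import Data.Fin using (Fin; zero; suc; punchIn; punchOut; inject≤; _≟_)
open import Data.Fin.Properties
  using (injective⇒≤; inject≤-injective; punchIn-punchOut; punchOut-injective; punchInᵢ≢i; punchIn-injective; any?; *↔×)
open import Data.Vec.Functional using (_∷_)
open import Data.Bool using (true)
open import Data.Product using (Σ; _×_; _,_; proj₁; proj₂)
open import Data.Empty using (⊥-elim)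
open import Function using (_∘_)
open import Function.Bundles using (Injection)
open import Function.Definitions using (Injective)
open import Function.Properties.Inverse using (↔⇒↣)
open import Relation.Binary.PropositionalEquality
open import Relation.Nullary using (¬_; yes; no)
open import Relation.Nullary.Decidable using (decidable-stable)

¬¬-∀-Fin : ∀ {p} {n} {P : Fin n → Set p} → (∀ i → ¬ ¬ P i) → ¬ ¬ (∀ i → P i)
¬¬-∀-Fin {n = zero}  ¬¬P ¬∀P = ¬∀P (λ ())
¬¬-∀-Fin {n = suc n} ¬¬P ¬∀P =
  ¬¬P zero λ P₀ → ¬¬-∀-Fin (¬¬P ∘ suc) λ P₊ → ¬∀P λ { zero → P₀ ; (suc i) → P₊ i }

vertexless-colourable : ∀ {m} (G : Graph m) (H : Graph 0) → GFreeColourable G H 0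
vertexless-colourable G H = (λ ()) , λ ()

colourable-mono : ∀ {M n} (G : Graph (suc M)) (H : Graph n) {c k} → c ≤ k →
  GFreeColourable G H c → GFreeColourable G H k
colourable-mono G H c≤k (π , free) = (λ w → inject≤ (π w) c≤k) , λ _ (f , inj , edges , col) →
  free (π (f zero)) (f , inj , edges , λ u →
    inject≤-injective c≤k c≤k _ _ (trans (col u) (sym (col zero))))

lower-injection : ∀ {m n} (f : Fin m → Fin (suc n)) → Injective _≡_ _≡_ f → (∀ u → zero ≢ f u) →
  Σ (Fin m → Fin n) λ g → Injective _≡_ _≡_ g × (∀ u → suc (g u) ≡ f u)
lower-injection f f-inj avoids =
  (λ u → punchOut (avoids u)) ,
  (λ {u} {u′} eq → f-inj (punchOut-injective (avoids u) (avoids u′) eq)) ,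
  (λ u → punchIn-punchOut (avoids u))

ClassHasAtLeast : ∀ {n k} → ℕ → (Fin n → Fin k) → Fin k → Set
ClassHasAtLeast {n} M π i = Σ (Fin M → Fin n) λ g → Injective _≡_ _≡_ g × (∀ j → π (g j) ≡ i)

large-classes⇒≤ : ∀ {n k M} (π : Fin n → Fin k) → (∀ i → ClassHasAtLeast M π i) → k * M ≤ n
large-classes⇒≤ {M = M} π large =
  injective⇒≤ (λ eq → Injection.injective (↔⇒↣ *↔×) (pick-injective eq))
  where
  pick : Fin _ × Fin M → Fin _
  pick (i , j) = proj₁ (large i) j

  pick-colour : ∀ i j → π (pick (i , j)) ≡ i
  pick-colour i j = proj₂ (proj₂ (large i)) j

  pick-injective : Injective _≡_ _≡_ pick
  pick-injective {i , j} {i′ , j′} eq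
    with refl ← trans (sym (pick-colour i j)) (trans (cong π eq) (pick-colour i′ j′))
    = cong (i ,_) (proj₁ (proj₂ (large i)) eq)

injection-through-zero : ∀ {M N k} {π : Fin N → Fin k} {i i′} (f : Fin (suc M) → Fin (suc N)) →
  Injective _≡_ _≡_ f → (∀ u → (i ∷ π) (f u) ≡ i′) → ∀ u₀ → f u₀ ≡ zero → ClassHasAtLeast M π i
injection-through-zero {π = π} {i} {i′} f f-inj col u₀ fu₀≡0 =
  let g , g-inj , g-lifts = lower-injection (f ∘ punchIn u₀) (punchIn-injective u₀ _ _ ∘ f-inj) others-avoid
  in g , g-inj , λ j → trans (cong (i ∷ π) (g-lifts j)) (trans (col (punchIn u₀ j)) i′≡i)
  where
  i′≡i : i′ ≡ i
  i′≡i = trans (sym (col u₀)) (cong (i ∷ π) fu₀≡0)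

  others-avoid : ∀ j → zero ≢ f (punchIn u₀ j)
  others-avoid j eq = punchInᵢ≢i u₀ j (f-inj (trans (sym eq) (sym fu₀≡0)))

module _ {M N k} (G : Graph (suc M)) (H : Graph (suc N)) (π : Fin N → Fin k)
         (free : IsGFreeColouring G (deleteVertex H zero) k π) where

  copy-avoiding-zero : ∀ {i i′} ((f , _ , _ , _) : SubgraphIn G H (λ w → (i ∷ π) w ≡ i′)) →
    ¬ (∀ u → zero ≢ f u)
  copy-avoiding-zero {i} {i′} (f , f-inj , edges , col) avoids
    with g , g-inj , g-lifts ← lower-injection f f-inj avoids
    = free i′ (g , g-inj , g-edges , λ u → trans (cong (i ∷ π) (g-lifts u)) (col u))
    where
    g-edges : ∀ a b → adj G a b ≡ true → adj H (suc (g a)) (suc (g b)) ≡ true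
    g-edges a b ab rewrite g-lifts a | g-lifts b = edges a b ab

  extend-free : ∀ i → ¬ ClassHasAtLeast M π i → IsGFreeColouring G H k (i ∷ π)
  extend-free i small _ copy@(f , f-inj , _ , col) with any? (λ u → f u ≟ zero)
  ... | yes (u₀ , fu₀≡0) = small (injection-through-zero f f-inj col u₀ fu₀≡0)
  ... | no avoids = copy-avoiding-zero copy (λ u eq → avoids (u , sym eq))

theorem11 : ∀ {m n} (G : Graph m) (H : Graph n) (k : ℕ) →
    2 ≤ m → 1 ≤ k → KGFreeVertexMinimal G H k →
    (k ∸ 1) * (m ∸ 1) + 1 ≤ n
theorem11 G H zero _ () _
theorem11 {n = zero} G H (suc K) _ _ ((_ , fewer-colours-fail) , _) =
  ⊥-elim (fewer-colours-fail 0 (s≤s z≤n) (vertexless-colourable G H))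
theorem11 {suc M} {suc N} G H (suc K) _ _ ((_ , fewer-colours-fail) , minimal)
  with minimal zero
... | c , (colourable , _) , c≤K
  with π , free ← colourable-mono G (deleteVertex H zero) c≤K colourable =
  subst (_≤ suc N) (+-comm 1 (K * M)) (s≤s (decidable-stable (K * M ≤? N) λ ¬bound →
    ¬¬-∀-Fin (λ i small → fewer-colours-fail K ≤-refl (i ∷ π , extend-free G H π free i small))
      (¬bound ∘ large-classes⇒≤ π)))
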